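{- For every integer $n\ge3$, \[ f_3(n^n,4)\ \le\ f_3(n,4)+\lceil \log n + C\log\log n\rceil+1, \] where $C=C(n)$ is as defined in the context.
   Context: Logarithms are base 2. $S_N$ is the set of permutations of $[N]$, viewed as linear orderings of $[N]$. For $P\in S_N$ and a 3-element $X\subseteq[N]$, $P_X\in S_3$ is the pattern (relative order) of $X$ in $P$. A family $\mathcal S\subseteq S_N$ partially shatters $X$ with $t$ orders if $|\{P_X:P\in\mathcal S\}|\ge t$, and $f_3(N,t)$ is the smallest size of a family in $S_N$ partially shattering every 3-subset of $[N]$ with $t$ orders. The quantity $C=C(n)=\tfrac12+o(1)$ is defined by the property that $\lceil\log n+C\log\log n\rceil$ is the minimum size of a family $\mathcal U$ of partitions $(A,B)$ of $[n]$ (with $A\cup B=[n]$, $A\cap B=\emptyset$) such that for every ordered pair of distinct $x,y\in[n]$ there is $(A,B)\in\mathcal U$ with $x\in A$ and $y\in B$. -}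

module Defs where

open import Data.Nat using (ℕ; _≤_)
open import Data.Bool using (Bool; true; false)
open import Data.Fin using (Fin) renaming (_<_ to _<ᶠ_; _<?_ to _<ᶠ?_)
open import Data.Fin.Permutation using (Permutation′; _⟨$⟩ʳ_)
open import Data.List using (List; length)
open import Data.List.Membership.Propositional using (_∈_)
open import Data.List.Relation.Unary.All using (All)
open import Data.List.Relation.Unary.Unique.Propositional using (Unique)
open import Data.Product using (Σ; ∃; _×_)
open import Relation.Nullary.Decidable using (⌊_⌋)
open import Relation.Binary.PropositionalEquality using (_≡_; _≢_)

-- A permutation P ∈ S_N, viewed as a linear ordering of [N] = Fin N:
-- P ⟨$⟩ʳ x is the position of the element x in the ordering, so
-- x precedes y in P iff P ⟨$⟩ʳ x < P ⟨$⟩ʳ y.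
Perm : ℕ → Set
Perm N = Permutation′ N

precedes : ∀ {N} → Perm N → Fin N → Fin N → Bool
precedes P x y = ⌊ (P ⟨$⟩ʳ x) <ᶠ? (P ⟨$⟩ʳ y) ⌋

-- The pattern P_X ∈ S_3 of X = {a < b < c}: the relative order of a, b, c
-- in P, encoded by the three pairwise comparisons (which determine it).
Pattern : Set
Pattern = Bool × Bool × Bool

pattern3 : ∀ {N} → Perm N → Fin N → Fin N → Fin N → Pattern
pattern3 P a b c = precedes P a b Data.Product., (precedes P a c Data.Product., precedes P b c)

PartiallyShatters : ∀ {N} → List (Perm N) → ℕ → Fin N → Fin N → Fin N → Set
PartiallyShatters 𝒮 t a b c =
  ∃ λ (L : List Pattern) →
    Unique L × t ≤ length L ×
    All (λ p → ∃ λ P → P ∈ 𝒮 × pattern3 P a b c ≡ p) L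

ShattersAll3 : ∀ {N} → List (Perm N) → ℕ → Set
ShattersAll3 {N} 𝒮 t =
  (a b c : Fin N) → a <ᶠ b → b <ᶠ c → PartiallyShatters 𝒮 t a b c

IsMinSize : ∀ {A : Set} → (List A → Set) → ℕ → Set
IsMinSize {A} Q m =
  (∃ λ (F : List A) → Q F × length F ≡ m) ×
  ((F : List A) → Q F → m ≤ length F)

IsF3 : ℕ → ℕ → ℕ → Set
IsF3 N t m = IsMinSize (λ (𝒮 : List (Perm N)) → ShattersAll3 𝒮 t) m

-- A partition (A,B) of [n] is encoded by its indicator S : Fin n → Bool,
-- with A = {x | S x ≡ true}, B = {x | S x ≡ false}.
-- 𝒰 separates all ordered pairs: for distinct x, y some (A,B) ∈ 𝒰 has x ∈ A, y ∈ B.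
SeparatesOrderedPairs : ∀ {n} → List (Fin n → Bool) → Set
SeparatesOrderedPairs {n} 𝒰 =
  (x y : Fin n) → x ≢ y → ∃ λ S → S ∈ 𝒰 × S x ≡ true × S y ≡ false

-- m = ⌈log n + C log log n⌉, i.e. the minimum size of such a family 𝒰.
IsSepMin : ℕ → ℕ → Set
IsSepMin n m = IsMinSize (λ (𝒰 : List (Fin n → Bool)) → SeparatesOrderedPairs 𝒰) m

{-# OPTIONS --safe #-}
-- Identify [n^n] with the words of length n over [n]. A sequence τ of n orders on [n] orders
-- words lexicographically, comparing the first differing letters by τ at that position. Take the
-- constant sequences (σ, …, σ) for σ in an optimal family for [n], and, for a fixed σ₀ in it and
-- each partition (A,B) of an optimal separating family or the trivial one (∅,[n]), the sequence
-- using σ₀ on A and reversed σ₀ on B. Among three distinct words, if the first letters are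
-- distinct, the constant sequences give four patterns; if they coincide, pass to the tails; if
-- exactly two coincide, the pattern is determined by the comparisons at position 0 and at the
-- first position where those two words differ, and the partition sequences together with the
-- constant σ₀ realise all four combinations of these two comparisons, since the partitions
-- separate every ordered pair of positions.
module Submission where

open import Defs
open import Data.Nat using (ℕ; _≤_; _+_; _^_)
open import Data.Nat using (zero; suc; s≤s; z≤n; _*_; _<_)
import Data.Nat.Properties as ℕ
open import Data.Bool using (Bool; true; false; not; _xor_)
open import Data.Bool.Properties using (not-involutive)
open import Data.Fin using (Fin; zero; suc; toℕ; combine; remQuot; opposite; _≟_)
  renaming (_<_ to _<ᶠ_; _<?_ to _<ᶠ?_)
open import Data.Fin.Properties
  using (<-cmp; <-asym; <-trans; <⇒≢; suc-injective; toℕ<n; opposite-prop; opposite-involutive;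
         toℕ-combine; combine-monoˡ-<; remQuot-combine; combine-remQuot)
open import Data.Fin.Permutation using (_⟨$⟩ʳ_; flip; _∘ₚ_; reverse; inverseˡ; inverseʳ)
open import Data.Vec using (Vec; []; _∷_; lookup)
open import Data.List using (List; []; _∷_; length; map; _++_)
open import Data.List.Properties using (length-map; length-++)
open import Data.List.Membership.Propositional using (_∈_)
open import Data.List.Membership.Propositional.Properties using (∈-map⁺; ∈-map⁻; ∈-++⁺ˡ; ∈-++⁺ʳ)
open import Data.List.Relation.Unary.Any using (here; there)
open import Data.List.Relation.Unary.All using (All; []; _∷_)
import Data.List.Relation.Unary.All as All
import Data.List.Relation.Unary.All.Properties as All
open import Data.List.Relation.Unary.AllPairs using ([]; _∷_)
open import Data.List.Relation.Unary.Unique.Propositional using (Unique)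
import Data.List.Relation.Unary.Unique.Propositional.Properties as Unique
open import Data.Product using (∃; _×_; _,_; proj₁; proj₂)
open import Function using (_∘_; id; _⇔_; mk⇔; _↔_; mk↔ₛ′; Injection)
open import Function.Construct.Composition using (_↔-∘_)
open import Function.Construct.Symmetry using (↔-sym)
open import Function.Properties.Inverse using (↔⇒↣)
open import Relation.Nullary using (¬_; Dec; yes; no; contradiction)
open import Relation.Nullary.Decidable using (⌊_⌋; isYes≗does; dec-true; dec-false; does-⇔)
open import Relation.Binary.PropositionalEquality
  using (_≡_; _≢_; refl; sym; trans; cong; cong₂; subst; subst₂; ≢-sym; module ≡-Reasoning)
open import Relation.Binary.Definitions using (tri<; tri≈; tri>)

⌊⌋-true : ∀ {A : Set} (a? : Dec A) → A → ⌊ a? ⌋ ≡ true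
⌊⌋-true a? a = trans (isYes≗does a?) (dec-true a? a)

⌊⌋-false : ∀ {A : Set} (a? : Dec A) → ¬ A → ⌊ a? ⌋ ≡ false
⌊⌋-false a? ¬a = trans (isYes≗does a?) (dec-false a? ¬a)

⌊⌋-⇔ : ∀ {A B : Set} → A ⇔ B → (a? : Dec A) (b? : Dec B) → ⌊ a? ⌋ ≡ ⌊ b? ⌋
⌊⌋-⇔ A⇔B a? b? = trans (isYes≗does a?) (trans (does-⇔ A⇔B a? b?) (sym (isYes≗does b?)))

<ᶠ?-flip : ∀ {N} {i j : Fin N} → i ≢ j → ⌊ j <ᶠ? i ⌋ ≡ not ⌊ i <ᶠ? j ⌋
<ᶠ?-flip {i = i} {j} i≢j with <-cmp i j
... | tri< i<j _ _ =
  trans (⌊⌋-false (j <ᶠ? i) (<-asym i<j)) (cong not (sym (⌊⌋-true (i <ᶠ? j) i<j)))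
... | tri≈ _ i≡j _ = contradiction i≡j i≢j
... | tri> _ _ j<i =
  trans (⌊⌋-true (j <ᶠ? i) j<i) (cong not (sym (⌊⌋-false (i <ᶠ? j) (<-asym j<i))))

opposite-< : ∀ {N} {i j : Fin N} → i <ᶠ j → opposite j <ᶠ opposite i
opposite-< {i = i} {j} i<j rewrite opposite-prop i | opposite-prop j =
  ℕ.∸-monoʳ-< (s≤s i<j) (toℕ<n j)

opposite-<? : ∀ {N} (i j : Fin N) → ⌊ opposite i <ᶠ? opposite j ⌋ ≡ ⌊ j <ᶠ? i ⌋
opposite-<? i j = ⌊⌋-⇔ (mk⇔ reflect opposite-<) (opposite i <ᶠ? opposite j) (j <ᶠ? i)
  where
  reflect : opposite i <ᶠ opposite j → j <ᶠ i
  reflect lt = subst₂ _<ᶠ_ (opposite-involutive j) (opposite-involutive i) (opposite-< lt)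

combine-<?-same : ∀ {n k} (u : Fin n) (r s : Fin k) →
  ⌊ combine u r <ᶠ? combine u s ⌋ ≡ ⌊ r <ᶠ? s ⌋
combine-<?-same {k = k} u r s = ⌊⌋-⇔ (mk⇔ cancel mono) (combine u r <ᶠ? combine u s) (r <ᶠ? s)
  where
  cancel : combine u r <ᶠ combine u s → r <ᶠ s
  cancel lt = ℕ.+-cancelˡ-< (k * toℕ u) (toℕ r) (toℕ s)
    (subst₂ _<_ (toℕ-combine u r) (toℕ-combine u s) lt)
  mono : r <ᶠ s → combine u r <ᶠ combine u s
  mono lt = subst₂ _<_ (sym (toℕ-combine u r)) (sym (toℕ-combine u s)) (ℕ.+-monoʳ-< (k * toℕ u) lt)

combine-<?-≢ : ∀ {n k} {u v : Fin n} (r s : Fin k) → u ≢ v →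
  ⌊ combine u r <ᶠ? combine v s ⌋ ≡ ⌊ u <ᶠ? v ⌋
combine-<?-≢ {u = u} {v} r s u≢v with <-cmp u v
... | tri< u<v _ _ =
  trans (⌊⌋-true (combine u r <ᶠ? combine v s) (combine-monoˡ-< r s u<v))
        (sym (⌊⌋-true (u <ᶠ? v) u<v))
... | tri≈ _ u≡v _ = contradiction u≡v u≢v
... | tri> _ _ v<u =
  trans (⌊⌋-false (combine u r <ᶠ? combine v s) (<-asym (combine-monoˡ-< s r v<u)))
        (sym (⌊⌋-false (u <ᶠ? v) (<-asym v<u)))

perm-injective : ∀ {N} (P : Perm N) {u v : Fin N} → u ≢ v → P ⟨$⟩ʳ u ≢ P ⟨$⟩ʳ v
perm-injective P u≢v = u≢v ∘ Injection.injective (↔⇒↣ P)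

patternBy : {A : Set} → (A → A → Bool) → A → A → A → Pattern
patternBy cmp x y z = cmp x y , cmp x z , cmp y z

Realizes : ℕ → {X : Set} → List X → (X → Pattern) → Set
Realizes t Fam f = ∃ λ (L : List Pattern) →
  Unique L × t ≤ length L × All (λ p → ∃ λ x → x ∈ Fam × f x ≡ p) L

module _ {t : ℕ} {X Y : Set} {Fam : List X} {Fam′ : List Y} {f : X → Pattern} {f′ : Y → Pattern} where

  realizes-map : (g g⁻¹ : Pattern → Pattern) → (∀ p → g⁻¹ (g p) ≡ p) →
    (∀ {x} → x ∈ Fam → ∃ λ y → y ∈ Fam′ × f′ y ≡ g (f x)) →
    Realizes t Fam f → Realizes t Fam′ f′
  realizes-map g g⁻¹ inverse covered (L , unique , t≤ , realized) =
    map g L , Unique.map⁺ g-injective unique , subst (t ≤_) (sym (length-map g L)) t≤ ,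
    All.map⁺ (All.map (λ { (x , x∈ , refl) → covered x∈ }) realized)
    where
    g-injective : ∀ {p q} → g p ≡ g q → p ≡ q
    g-injective {p} {q} eq = trans (sym (inverse p)) (trans (cong g⁻¹ eq) (inverse q))

  realizes-transfer : (∀ {x} → x ∈ Fam → ∃ λ y → y ∈ Fam′ × f′ y ≡ f x) →
    Realizes t Fam f → Realizes t Fam′ f′
  realizes-transfer = realizes-map id id (λ _ → refl)

realizes-four : ∀ {X : Set} {Fam : List X} {f : X → Pattern} (h : Bool → Bool → Pattern) →
  Unique (h true true ∷ h true false ∷ h false true ∷ h false false ∷ []) →
  (∀ e₁ e₂ → ∃ λ x → x ∈ Fam × f x ≡ h e₁ e₂) → Realizes 4 Fam f
realizes-four h unique realize = _ , unique , s≤s (s≤s (s≤s (s≤s z≤n))) ,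
  realize true true ∷ realize true false ∷ realize false true ∷ realize false false ∷ []

Tournament : {A : Set} → (A → A → Bool) → Set
Tournament {A} cmp = ∀ {x y : A} → x ≢ y → cmp y x ≡ not (cmp x y)

swap₁₂ : Pattern → Pattern
swap₁₂ (p , q , r) = not p , r , q

swap₂₃ : Pattern → Pattern
swap₂₃ (p , q , r) = q , p , not r

swap₁₂-involutive : ∀ p → swap₁₂ (swap₁₂ p) ≡ p
swap₁₂-involutive (p , q , r) = cong (λ b → b , q , r) (not-involutive p)

swap₂₃-involutive : ∀ p → swap₂₃ (swap₂₃ p) ≡ p
swap₂₃-involutive (p , q , r) = cong (λ b → p , q , b) (not-involutive r)

module _ {t : ℕ} {X A : Set} {Fam : List X}
         {cmp : X → A → A → Bool} (tournament : ∀ x → Tournament (cmp x)) where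

  realizes-swap₁₂ : ∀ {u v w} → u ≢ v →
    Realizes t Fam (λ x → patternBy (cmp x) u v w) → Realizes t Fam (λ x → patternBy (cmp x) v u w)
  realizes-swap₁₂ {u} {v} {w} u≢v = realizes-map swap₁₂ swap₁₂ swap₁₂-involutive
    (λ {x} x∈ → x , x∈ , cong (λ b → b , cmp x v w , cmp x u w) (tournament x u≢v))

  realizes-swap₂₃ : ∀ {u v w} → v ≢ w →
    Realizes t Fam (λ x → patternBy (cmp x) u v w) → Realizes t Fam (λ x → patternBy (cmp x) u w v)
  realizes-swap₂₃ {u} {v} {w} v≢w = realizes-map swap₂₃ swap₂₃ swap₂₃-involutive
    (λ {x} x∈ → x , x∈ , cong (λ b → cmp x u w , cmp x u v , b) (tournament x v≢w))

precedes-tournament : ∀ {N} (P : Perm N) → Tournament (precedes P)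
precedes-tournament P u≢v = <ᶠ?-flip (perm-injective P u≢v)

realizes-distinct : ∀ {N} {F : List (Perm N)} → ShattersAll3 F 4 →
  ∀ {u v w} → u ≢ v → u ≢ w → v ≢ w → Realizes 4 F (λ P → pattern3 P u v w)
realizes-distinct shatters {u} {v} {w} u≢v u≢w v≢w with <-cmp u v | <-cmp u w | <-cmp v w
... | tri≈ _ u≡v _ | _ | _ = contradiction u≡v u≢v
... | _ | tri≈ _ u≡w _ | _ = contradiction u≡w u≢w
... | _ | _ | tri≈ _ v≡w _ = contradiction v≡w v≢w
... | tri< u<v _ _ | _ | tri< v<w _ _ =
  shatters u v w u<v v<w
... | tri< _ _ _ | tri< u<w _ _ | tri> _ _ w<v =
  realizes-swap₂₃ precedes-tournament (≢-sym v≢w)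
    (shatters u w v u<w w<v)
... | tri< u<v _ _ | tri> _ _ w<u | tri> _ _ _ =
  realizes-swap₂₃ precedes-tournament (≢-sym v≢w)
    (realizes-swap₁₂ precedes-tournament (≢-sym u≢w)
      (shatters w u v w<u u<v))
... | tri> _ _ v<u | tri< u<w _ _ | _ =
  realizes-swap₁₂ precedes-tournament (≢-sym u≢v)
    (shatters v u w v<u u<w)
... | tri> _ _ _ | tri> _ _ w<u | tri< v<w _ _ =
  realizes-swap₁₂ precedes-tournament (≢-sym u≢v)
    (realizes-swap₂₃ precedes-tournament (≢-sym u≢w)
      (shatters v w u v<w w<u))
... | tri> _ _ v<u | tri> _ _ _ | tri> _ _ w<v =
  realizes-swap₁₂ precedes-tournament (≢-sym u≢v)
    (realizes-swap₂₃ precedes-tournament (≢-sym u≢w)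
      (realizes-swap₁₂ precedes-tournament (≢-sym v≢w)
        (shatters w v u w<v v<u)))

reversed : ∀ {N} → Perm N → Perm N
reversed σ = σ ∘ₚ reverse

precedes-reversed : ∀ {N} (σ : Perm N) {u v} → u ≢ v → precedes (reversed σ) u v ≡ not (precedes σ u v)
precedes-reversed σ {u} {v} u≢v =
  trans (opposite-<? (σ ⟨$⟩ʳ u) (σ ⟨$⟩ʳ v)) (precedes-tournament σ u≢v)

oriented : ∀ {N} → Bool → Perm N → Perm N
oriented true σ = σ
oriented false σ = reversed σ

precedes-oriented : ∀ {N} (σ : Perm N) {u v} → u ≢ v → ∀ {s} e →
  s ≡ not (e xor precedes σ u v) → precedes (oriented s σ) u v ≡ e
precedes-oriented σ {u} {v} u≢v e refl with precedes σ u v in eq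
precedes-oriented σ u≢v true  refl | true  = eq
precedes-oriented σ u≢v false refl | false = eq
precedes-oriented σ u≢v true  refl | false = trans (precedes-reversed σ u≢v) (cong not eq)
precedes-oriented σ u≢v false refl | true  = trans (precedes-reversed σ u≢v) (cong not eq)

withConstants : ∀ {n} → List (Fin n → Bool) → List (Fin n → Bool)
withConstants U = (λ _ → true) ∷ (λ _ → false) ∷ U

withConstants-pairs : ∀ {n} {U : List (Fin n → Bool)} → SeparatesOrderedPairs U →
  ∀ {i j} → i ≢ j → ∀ e₁ e₂ → ∃ λ S → S ∈ withConstants U × S i ≡ e₁ × S j ≡ e₂
withConstants-pairs separates i≢j true  true  = _ , here refl , refl , refl
withConstants-pairs separates i≢j false false = _ , there (here refl) , refl , refl
withConstants-pairs separates {i} {j} i≢j true false with separates i j i≢j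
... | S , S∈ , Si , Sj = S , there (there S∈) , Si , Sj
withConstants-pairs separates {i} {j} i≢j false true with separates j i (≢-sym i≢j)
... | S , S∈ , Sj , Si = S , there (there S∈) , Si , Sj

shift : ∀ {n m} → (Fin (suc m) → Perm n) → Fin m → Perm n
shift τ = τ ∘ suc

lex : ∀ {n m} → (Fin m → Perm n) → Vec (Fin n) m → Vec (Fin n) m → Bool
lex τ [] [] = false
lex τ (u ∷ X) (v ∷ Y) with u ≟ v
... | yes _ = lex (shift τ) X Y
... | no _ = precedes (τ zero) u v

lex-≡ : ∀ {n m} (τ : Fin (suc m) → Perm n) u X Y → lex τ (u ∷ X) (u ∷ Y) ≡ lex (shift τ) X Y
lex-≡ τ u X Y with u ≟ u
... | yes _ = refl
... | no u≢u = contradiction refl u≢u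

lex-≢ : ∀ {n m} (τ : Fin (suc m) → Perm n) {u v} X Y → u ≢ v →
  lex τ (u ∷ X) (v ∷ Y) ≡ precedes (τ zero) u v
lex-≢ τ {u} {v} X Y u≢v with u ≟ v
... | yes u≡v = contradiction u≡v u≢v
... | no _ = refl

lex-tournament : ∀ {n m} (τ : Fin m → Perm n) → Tournament (lex τ)
lex-tournament τ {[]} {[]} []≢[] = contradiction refl []≢[]
lex-tournament τ {u ∷ X} {v ∷ Y} uX≢vY with u ≟ v
... | yes refl = trans (lex-≡ τ u Y X) (lex-tournament (shift τ) (uX≢vY ∘ cong (u ∷_)))
... | no u≢v = trans (lex-≢ τ Y X (≢-sym u≢v)) (precedes-tournament (τ zero) u≢v)

firstDifference : ∀ {n m} (X Y : Vec (Fin n) m) → X ≢ Y →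
  ∃ λ j → lookup X j ≢ lookup Y j × (∀ τ → lex τ X Y ≡ precedes (τ j) (lookup X j) (lookup Y j))
firstDifference [] [] []≢[] = contradiction refl []≢[]
firstDifference (u ∷ X) (v ∷ Y) uX≢vY with u ≟ v
... | no u≢v = zero , u≢v , λ τ → refl
... | yes refl with firstDifference X Y (uX≢vY ∘ cong (u ∷_))
...   | j , Xj≢Yj , lex≡ = suc j , Xj≢Yj , λ τ → lex≡ (shift τ)

ShattersEachCoordinate : ∀ {n m} → List (Fin m → Perm n) → Set
ShattersEachCoordinate {n} {m} T = ∀ (i : Fin m) {u v w : Fin n} → u ≢ v → u ≢ w → v ≢ w →
  Realizes 4 T (λ τ → pattern3 (τ i) u v w)

IndependentCoordinates : ∀ {n m} → List (Fin m → Perm n) → Set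
IndependentCoordinates {n} {m} T = ∀ {i j : Fin m} → i ≢ j → ∀ {u v p q : Fin n} → u ≢ v → p ≢ q →
  ∀ e₁ e₂ → ∃ λ τ → τ ∈ T × precedes (τ i) u v ≡ e₁ × precedes (τ j) p q ≡ e₂

shatters-shift : ∀ {n m} {T : List (Fin (suc m) → Perm n)} →
  ShattersEachCoordinate T → ShattersEachCoordinate (map shift T)
shatters-shift shatters i u≢v u≢w v≢w =
  realizes-transfer (λ {τ} τ∈ → shift τ , ∈-map⁺ shift τ∈ , refl) (shatters (suc i) u≢v u≢w v≢w)

independent-shift : ∀ {n m} {T : List (Fin (suc m) → Perm n)} →
  IndependentCoordinates T → IndependentCoordinates (map shift T)
independent-shift independent i≢j u≢v p≢q e₁ e₂ with independent (i≢j ∘ suc-injective) u≢v p≢q e₁ e₂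
... | τ , τ∈ , prec₁ , prec₂ = shift τ , ∈-map⁺ shift τ∈ , prec₁ , prec₂

lex-realizes-twoHeadsEqual : ∀ {n m} (T : List (Fin (suc m) → Perm n)) → IndependentCoordinates T →
  ∀ {x z X Y Z} → x ≢ z → X ≢ Y → Realizes 4 T (λ τ → patternBy (lex τ) (x ∷ X) (x ∷ Y) (z ∷ Z))
lex-realizes-twoHeadsEqual T independent {x} {z} {X} {Y} {Z} x≢z X≢Y with firstDifference X Y X≢Y
... | j , Xj≢Yj , lexXY = realizes-four (λ e₁ e₂ → e₂ , e₁ , e₁)
  (((λ ()) ∷ (λ ()) ∷ (λ ()) ∷ []) ∷ ((λ ()) ∷ (λ ()) ∷ []) ∷ ((λ ()) ∷ []) ∷ [] ∷ [])
  realize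
  where
  -- x ∷ X and x ∷ Y are compared at position suc j, and both are compared with z ∷ Z at position 0.
  realize : ∀ e₁ e₂ → ∃ λ τ → τ ∈ T × patternBy (lex τ) (x ∷ X) (x ∷ Y) (z ∷ Z) ≡ (e₂ , e₁ , e₁)
  realize e₁ e₂ with independent {zero} {suc j} (λ ()) x≢z Xj≢Yj e₁ e₂
  ... | τ , τ∈ , prec₁ , prec₂ = τ , τ∈ ,
    cong₂ _,_ (trans (lex-≡ τ x X Y) (trans (lexXY (shift τ)) prec₂))
      (cong₂ _,_ (trans (lex-≢ τ X Z x≢z) prec₁) (trans (lex-≢ τ Y Z x≢z) prec₁))

-- The head comparisons are taken as arguments rather than by `with`, which would also abstract
-- the `x ≟ y` inside `lex` and make the goal ill-typed.
lex-realizes-∷ : ∀ {n m} (T : List (Fin (suc m) → Perm n)) →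
  ShattersEachCoordinate T → IndependentCoordinates T →
  (∀ {X Y Z} → X ≢ Y → X ≢ Z → Y ≢ Z → Realizes 4 (map shift T) (λ τ → patternBy (lex τ) X Y Z)) →
  ∀ {x y z X Y Z} → Dec (x ≡ y) → Dec (x ≡ z) → Dec (y ≡ z) →
  x ∷ X ≢ y ∷ Y → x ∷ X ≢ z ∷ Z → y ∷ Y ≢ z ∷ Z →
  Realizes 4 T (λ τ → patternBy (lex τ) (x ∷ X) (y ∷ Y) (z ∷ Z))
lex-realizes-∷ T shatters independent tails {x} {X = X} {Y} {Z} (yes refl) (yes refl) _ xX≢xY xX≢xZ xY≢xZ =
  realizes-transfer fromTails
    (tails (xX≢xY ∘ cong (x ∷_)) (xX≢xZ ∘ cong (x ∷_)) (xY≢xZ ∘ cong (x ∷_)))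
  where
  fromTails : ∀ {τ′} → τ′ ∈ map shift T →
    ∃ λ τ → τ ∈ T × patternBy (lex τ) (x ∷ X) (x ∷ Y) (x ∷ Z) ≡ patternBy (lex τ′) X Y Z
  fromTails τ′∈ with ∈-map⁻ shift τ′∈
  ... | τ , τ∈ , refl = τ , τ∈ , cong₂ _,_ (lex-≡ τ x X Y) (cong₂ _,_ (lex-≡ τ x X Z) (lex-≡ τ x Y Z))
lex-realizes-∷ T _ independent _ {x} (yes refl) (no x≢z) _ xX≢xY _ _ =
  lex-realizes-twoHeadsEqual T independent x≢z (xX≢xY ∘ cong (x ∷_))
lex-realizes-∷ T _ independent _ {x} {y} {X = X} {Y} {Z} (no x≢y) (yes refl) _ _ xX≢xZ yY≢xZ =
  realizes-swap₂₃ lex-tournament {u = x ∷ X} {x ∷ Z} {y ∷ Y} (≢-sym yY≢xZ)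
    (lex-realizes-twoHeadsEqual T independent x≢y (xX≢xZ ∘ cong (x ∷_)))
lex-realizes-∷ T _ independent _ {x} {y} {X = X} {Y} {Z} (no x≢y) (no _) (yes refl) xX≢yY xX≢yZ yY≢yZ =
  realizes-swap₁₂ lex-tournament {u = y ∷ Y} {x ∷ X} {y ∷ Z} (≢-sym xX≢yY)
    (realizes-swap₂₃ lex-tournament {u = y ∷ Y} {y ∷ Z} {x ∷ X} (≢-sym xX≢yZ)
      (lex-realizes-twoHeadsEqual T independent (≢-sym x≢y) (yY≢yZ ∘ cong (y ∷_))))
lex-realizes-∷ T shatters _ _ {X = X} {Y} {Z} (no x≢y) (no x≢z) (no y≢z) _ _ _ =
  realizes-transfer (λ {τ} τ∈ → τ , τ∈ ,
      cong₂ _,_ (lex-≢ τ X Y x≢y) (cong₂ _,_ (lex-≢ τ X Z x≢z) (lex-≢ τ Y Z y≢z)))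
    (shatters zero x≢y x≢z y≢z)

lex-realizes : ∀ {n m} (T : List (Fin m → Perm n)) → ShattersEachCoordinate T → IndependentCoordinates T →
  ∀ {X Y Z} → X ≢ Y → X ≢ Z → Y ≢ Z → Realizes 4 T (λ τ → patternBy (lex τ) X Y Z)
lex-realizes T shatters independent {[]} {[]} {[]} []≢[] _ _ = contradiction refl []≢[]
lex-realizes T shatters independent {x ∷ X} {y ∷ Y} {z ∷ Z} =
  lex-realizes-∷ T shatters independent
    (lex-realizes (map shift T) (shatters-shift shatters) (independent-shift independent))
    (x ≟ y) (x ≟ z) (y ≟ z)

encode : ∀ {n m} → Vec (Fin n) m → Fin (n ^ m)
encode [] = zero
encode (u ∷ X) = combine u (encode X)

decode : ∀ {n m} → Fin (n ^ m) → Vec (Fin n) m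
decode {n} {zero} _ = []
decode {n} {suc m} x = proj₁ (remQuot {n} (n ^ m) x) ∷ decode (proj₂ (remQuot {n} (n ^ m) x))

decode-encode : ∀ {n m} (X : Vec (Fin n) m) → decode (encode X) ≡ X
decode-encode [] = refl
decode-encode {n} {suc m} (u ∷ X) = begin
  decode (combine u (encode X))
    ≡⟨ cong (λ (q : Fin n × Fin (n ^ m)) → proj₁ q ∷ decode (proj₂ q)) (remQuot-combine u (encode X)) ⟩
  u ∷ decode (encode X)
    ≡⟨ cong (u ∷_) (decode-encode X) ⟩
  u ∷ X ∎
  where open ≡-Reasoning

encode-decode : ∀ {n m} (x : Fin (n ^ m)) → encode {n} {m} (decode x) ≡ x
encode-decode {n} {zero} zero = refl
encode-decode {n} {suc m} x = begin
  combine u (encode {n} {m} (decode r)) ≡⟨ cong (combine u) (encode-decode {n} {m} r) ⟩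
  combine u r                           ≡⟨ combine-remQuot {n} (n ^ m) x ⟩
  x                                     ∎
  where
  open ≡-Reasoning
  u : Fin n
  u = proj₁ (remQuot {n} (n ^ m) x)
  r : Fin (n ^ m)
  r = proj₂ (remQuot {n} (n ^ m) x)

words↔ : ∀ {n m} → Vec (Fin n) m ↔ Fin (n ^ m)
words↔ {n} {m} = mk↔ₛ′ encode decode (encode-decode {n} {m}) decode-encode

decode-injective : ∀ {n m} {x y : Fin (n ^ m)} → x ≢ y → decode {n} {m} x ≢ decode y
decode-injective {n} {m} {x} {y} x≢y eq =
  x≢y (trans (sym (encode-decode {n} {m} x)) (trans (cong encode eq) (encode-decode {n} {m} y)))

permuteLetters : ∀ {n m} → (Fin m → Perm n) → Vec (Fin n) m → Vec (Fin n) m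
permuteLetters τ [] = []
permuteLetters τ (u ∷ X) = (τ zero ⟨$⟩ʳ u) ∷ permuteLetters (shift τ) X

permuteLetters-cancel : ∀ {n m} (σ τ : Fin m → Perm n) → (∀ i u → σ i ⟨$⟩ʳ (τ i ⟨$⟩ʳ u) ≡ u) →
  ∀ X → permuteLetters σ (permuteLetters τ X) ≡ X
permuteLetters-cancel σ τ cancel [] = refl
permuteLetters-cancel σ τ cancel (u ∷ X) =
  cong₂ _∷_ (cancel zero u) (permuteLetters-cancel (shift σ) (shift τ) (cancel ∘ suc) X)

letterwise : ∀ {n m} → (Fin m → Perm n) → Vec (Fin n) m ↔ Vec (Fin n) m
letterwise τ = mk↔ₛ′ (permuteLetters τ) (permuteLetters (flip ∘ τ))
  (permuteLetters-cancel τ (flip ∘ τ) (λ i _ → inverseʳ (τ i)))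
  (permuteLetters-cancel (flip ∘ τ) τ (λ i _ → inverseˡ (τ i)))

lexPerm : ∀ {n m} → (Fin m → Perm n) → Perm (n ^ m)
lexPerm τ = words↔ ↔-∘ (letterwise τ ↔-∘ ↔-sym words↔)

encode-permuteLetters-< : ∀ {n m} (τ : Fin m → Perm n) X Y →
  ⌊ encode (permuteLetters τ X) <ᶠ? encode (permuteLetters τ Y) ⌋ ≡ lex τ X Y
encode-permuteLetters-< τ [] [] = refl
encode-permuteLetters-< τ (u ∷ X) (v ∷ Y) with u ≟ v
... | yes refl = trans (combine-<?-same (τ zero ⟨$⟩ʳ u) _ _) (encode-permuteLetters-< (shift τ) X Y)
... | no u≢v = combine-<?-≢ _ _ (perm-injective (τ zero) u≢v)

precedes-lexPerm : ∀ {n m} (τ : Fin m → Perm n) x y → precedes (lexPerm τ) x y ≡ lex τ (decode x) (decode y)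
precedes-lexPerm τ x y = encode-permuteLetters-< τ (decode x) (decode y)

lexPerm-shatters : ∀ {n m} (T : List (Fin m → Perm n)) → ShattersEachCoordinate T → IndependentCoordinates T →
  ShattersAll3 (map lexPerm T) 4
lexPerm-shatters T shatters independent x y z x<y y<z =
  realizes-transfer (λ {τ} τ∈ → lexPerm τ , ∈-map⁺ lexPerm τ∈ ,
      cong₂ _,_ (precedes-lexPerm τ x y) (cong₂ _,_ (precedes-lexPerm τ x z) (precedes-lexPerm τ y z)))
    (lex-realizes T shatters independent
      (decode-injective (<⇒≢ x<y)) (decode-injective (<⇒≢ (<-trans x<y y<z))) (decode-injective (<⇒≢ y<z)))

shatters-nonempty : ∀ {N} {F : List (Perm N)} → 3 ≤ N → ShattersAll3 F 4 → ∃ λ σ → σ ∈ F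
shatters-nonempty (s≤s (s≤s (s≤s _))) shatters
  with shatters zero (suc zero) (suc (suc zero)) (s≤s z≤n) (s≤s (s≤s z≤n))
... | [] , _ , () , _
... | _ ∷ _ , _ , _ , (σ , σ∈ , _) ∷ _ = σ , σ∈

module PartitionCoordinates {n} (F : List (Perm n)) (U : List (Fin n → Bool))
                            {σ₀ : Perm n} (σ₀∈F : σ₀ ∈ F) where

  constant : Perm n → Fin n → Perm n
  constant σ _ = σ

  colouring : (Fin n → Bool) → Fin n → Perm n
  colouring S i = oriented (S i) σ₀

  -- The colouring by the constant true is constant σ₀, so it is already among the constants.
  coordinates : List (Fin n → Perm n)
  coordinates = map constant F ++ map colouring ((λ _ → false) ∷ U)

  colouring-∈ : ∀ {S} → S ∈ withConstants U → colouring S ∈ coordinates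
  colouring-∈ (here refl) = ∈-++⁺ˡ (∈-map⁺ constant σ₀∈F)
  colouring-∈ (there S∈) = ∈-++⁺ʳ (map constant F) (∈-map⁺ colouring S∈)

  coordinates-shatter : ShattersAll3 F 4 → ShattersEachCoordinate coordinates
  coordinates-shatter shatters i u≢v u≢w v≢w =
    realizes-transfer (λ {σ} σ∈ → constant σ , ∈-++⁺ˡ (∈-map⁺ constant σ∈) , refl)
      (realizes-distinct shatters u≢v u≢w v≢w)

  coordinates-independent : SeparatesOrderedPairs U → IndependentCoordinates coordinates
  coordinates-independent separates i≢j {u} {v} {p} {q} u≢v p≢q e₁ e₂
    with withConstants-pairs separates i≢j (not (e₁ xor precedes σ₀ u v)) (not (e₂ xor precedes σ₀ p q))
  ... | S , S∈ , Si , Sj =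
    colouring S , colouring-∈ S∈ , precedes-oriented σ₀ u≢v e₁ Si , precedes-oriented σ₀ p≢q e₂ Sj

  length-coordinates : length (map lexPerm coordinates) ≡ length F + length U + 1
  length-coordinates = begin
    length (map lexPerm coordinates)
      ≡⟨ length-map lexPerm coordinates ⟩
    length (map constant F ++ map colouring ((λ _ → false) ∷ U))
      ≡⟨ length-++ (map constant F) ⟩
    length (map constant F) + length (map colouring ((λ _ → false) ∷ U))
      ≡⟨ cong₂ _+_ (length-map constant F) (length-map colouring ((λ _ → false) ∷ U)) ⟩
    length F + suc (length U)
      ≡⟨ ℕ.+-suc (length F) (length U) ⟩
    suc (length F + length U)
      ≡⟨ ℕ.+-comm 1 (length F + length U) ⟩
    length F + length U + 1 ∎
    where open ≡-Reasoning

lemma2p6 : (n : ℕ) → 3 ≤ n →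
    (a b k : ℕ) → IsF3 (n ^ n) 4 a → IsF3 n 4 b → IsSepMin n k →
    a ≤ b + k + 1
lemma2p6 n 3≤n a b k (_ , a-minimal) ((F , F-shatters , |F|≡b) , _) ((U , U-separates , |U|≡k) , _)
  with shatters-nonempty 3≤n F-shatters
... | σ₀ , σ₀∈F = subst (a ≤_) |family|≡b+k+1 (a-minimal (map lexPerm coordinates) family-shatters)
  where
  open PartitionCoordinates F U σ₀∈F

  family-shatters : ShattersAll3 (map lexPerm coordinates) 4
  family-shatters =
    lexPerm-shatters coordinates (coordinates-shatter F-shatters) (coordinates-independent U-separates)

  |family|≡b+k+1 : length (map lexPerm coordinates) ≡ b + k + 1
  |family|≡b+k+1 = trans length-coordinates (cong₂ (λ x y → x + y + 1) |F|≡b |U|≡k)
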